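{- Let $m$ be an integer with $m \equiv 1 \pmod 3$ such that $D = 9m^2+4m$ is square-free, and let $K=\mathbb{Q}(\sqrt{D})$ with class number $h_K$. If $m \notin \{ -5, 1\}$, then $h_K \geq 3$.
   Context: $K=\mathbb{Q}(\sqrt{D})$ is a real quadratic field (note $D>0$ for such $m$); $h_K$ denotes the order of its (ordinary) ideal class group. -}

module Defs where

open import Data.Nat as ℕ using (ℕ)
import Data.Nat.Divisibility as ℕD
open import Data.Integer using (ℤ; +_; -[1+_]; _+_; _*_; _-_; ∣_∣)
open import Data.Integer.Divisibility using (_∣_)
open import Data.Product using (Σ; ∃; _×_; _,_; proj₁; proj₂)
open import Data.Sum using (_⊎_)
open import Relation.Binary.PropositionalEquality using (_≡_)
open import Relation.Nullary using (¬_)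
open import Function.Bundles using (_⇔_)

-- Square-free integer: the only natural n with n² ∣ |d| is n = 1
-- (this excludes d = 0, since then n = 0 would qualify).
SquareFree : ℤ → Set
SquareFree d = ∀ (n : ℕ) → (n ℕ.* n) ℕD.∣ ∣ d ∣ → n ≡ 1

-- Elements of K = Q(√D) of the form (x + y√D)/2 with x y ∈ ℤ.
-- Every element of O_K has a unique such representation.
record Elt : Set where
  constructor ⟨_,_⟩
  field
    x : ℤ
    y : ℤ
open Elt public

-- Membership in the ring of integers O_K of Q(√D) (D square-free, D ≠ 1):
-- if D ≡ 1 (mod 4): O_K = { (x + y√D)/2 : x ≡ y (mod 2) };
-- otherwise       : O_K = { a + b√D } = { (x + y√D)/2 : x, y even }.
InO : ℤ → Elt → Set
InO D α = (((+ 4) ∣ (D - + 1)) × ((+ 2) ∣ (x α - y α)))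
        ⊎ (¬ ((+ 4) ∣ (D - + 1)) × (((+ 2) ∣ x α) × ((+ 2) ∣ y α)))

zeroE : Elt
zeroE = ⟨ + 0 , + 0 ⟩

_+E_ : Elt → Elt → Elt
α +E β = ⟨ x α + x β , y α + y β ⟩

-- γ = α · β in K:  (x₁+y₁√D)/2 · (x₂+y₂√D)/2 = ((x₁x₂+D y₁y₂)/2 + (x₁y₂+x₂y₁)/2 √D)/2
IsProd : ℤ → Elt → Elt → Elt → Set
IsProd D α β γ = ((+ 2) * x γ ≡ x α * x β + D * (y α * y β))
               × ((+ 2) * y γ ≡ x α * y β + x β * y α)

record Ideal (D : ℤ) : Set₁ where
  field
    mem      : Elt → Set
    sub      : ∀ {α} → mem α → InO D α
    zero-mem : mem zeroE
    add-mem  : ∀ {α β} → mem α → mem β → mem (α +E β)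
    mul-mem  : ∀ {r α γ} → InO D r → mem α → IsProd D r α γ → mem γ
open Ideal public

NonzeroIdeal : ∀ {D} → Ideal D → Set
NonzeroIdeal I = ∃ λ α → mem I α × ¬ (α ≡ zeroE)

InScaled : ℤ → Elt → ∀ {D'} → Ideal D' → Elt → Set
InScaled D α I γ = ∃ λ i → mem I i × IsProd D α i γ

SameClass : (D : ℤ) → Ideal D → Ideal D → Set
SameClass D I J = ∃ λ α → ∃ λ β →
  InO D α × ¬ (α ≡ zeroE) × InO D β × ¬ (β ≡ zeroE) ×
  (∀ γ → InScaled D α I γ ⇔ InScaled D β J γ)

ClassNumber≥3 : ℤ → Set₁
ClassNumber≥3 D = Σ (Ideal D) λ I₁ → Σ (Ideal D) λ I₂ → Σ (Ideal D) λ I₃ →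
  NonzeroIdeal I₁ × NonzeroIdeal I₂ × NonzeroIdeal I₃ ×
  ¬ SameClass D I₁ I₂ × ¬ SameClass D I₁ I₃ × ¬ SameClass D I₂ I₃

Dof : ℤ → ℤ
Dof m = (+ 9) * (m * m) + (+ 4) * m

-- Write the integers of K = ℚ(√D) as (x + y√D)/2. As D is squarefree, m is odd, so m = 6u + 1,
-- D ≡ 1 (mod 12), and 3 splits into the primes P σ = {(x + y√D)/2 ∈ O_K : x ≡ σ y (mod 3)}, σ = ±1.
-- The key fact is that an integer of O_K whose norm T satisfies 3 ∣ T and |T| ≤ 9 is divisible by 3.
-- Substituting x = y + 2k, s = 3k − (27u + 4) y turns N(z) = T into F(y, s) = 9T for the form
-- F(y, s) = (y + s)² + 9mys, and Vieta jumping y ↦ −(9m + 2)s − y, which fixes F, shrinks every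
-- solution (for |m| ≥ 7) down to one with s = 0, where y² = 9T; divisibility by 3 then propagates back.
-- If αI = βJ for two of the ideals O, P₊, P₋, evaluating on 3 yields β j = kα with j ∈ J whose norm is
-- small (the two cofactor norms multiply to 9, resp. 81), so 3 ∣ j by the key fact. For O ~ P σ this
-- makes 3 divide ω = 1 + σ√D; for P σ ~ P (−σ), evaluating on ω ∈ P σ puts j/3 into P (−σ), so that
-- 27 divides the norm of j, which is too large.

module Submission where

open import Data.Nat as ℕ using (zero; suc; z≤n; s≤s)
import Data.Nat.Properties as ℕ
import Data.Nat.Divisibility as ℕ
open import Data.Nat.Primality using (Prime; prime?; euclidsLemma)
open import Data.Nat.Tactic.RingSolver using () renaming (solve-∀ to ℕ-solve-∀)
open import Data.Integer using (ℤ; +_; -[1+_]; +[1+_]; _+_; _*_; _-_; -_; ∣_∣; ≢-nonZero)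
open import Data.Integer.Properties
  using (abs-*; ∣i+j∣≤∣i∣+∣j∣; ∣i-j∣≤∣i∣+∣j∣; ∣i∣≡0⇒i≡0; ∣-i∣≡∣i∣; pos-*; neg-involutive;
         *-comm; *-identityˡ; *-zeroʳ; +-identityʳ; *-cancelˡ-≡; *-cancelʳ-≡; i*j≡0⇒i≡0∨j≡0)
open import Data.Integer.DivMod using (_%ℕ_; _/ℕ_; a≡a%ℕn+[a/ℕn]*n; n%ℕd<d)
open import Data.Integer.Tactic.RingSolver using (solve-∀)
open import Data.Integer.Divisibility using () renaming (_∣_ to _∣ᵤ_)
open import Data.Integer.Divisibility.Signed
  using (_∣_; divides; quotient; ∣⇒∣ᵤ; ∣ᵤ⇒∣; ∣-refl; ∣-trans; ∣m∣n⇒∣m+n; ∣m∣n⇒∣m-n; ∣n⇒∣m*n; ∣m⇒∣m*n;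
         ∣m⇒∣-m; ∣m+n∣n⇒∣m; ∣m+n∣m⇒∣n; *-cancelˡ-∣)
open import Data.Product using (∃; _×_; _,_; proj₁; proj₂)
open import Data.Sum using (_⊎_; inj₁; inj₂; [_,_]′)
open import Data.Empty using (⊥; ⊥-elim)
open import Function using (_∘_; id; case_of_)
open import Function.Bundles using (Equivalence)
open import Relation.Nullary using (¬_; yes; no)
open import Relation.Nullary.Decidable using (from-yes; from-no)
open import Relation.Binary.PropositionalEquality

open import Defs

*-∣-* : ∀ {k l a b} → k ∣ a → l ∣ b → k * l ∣ a * b
*-∣-* {k} {l} (divides p refl) (divides q refl) = divides (p * q) (poly p k q l)
  where
  poly : ∀ p k q l → (p * k) * (q * l) ≡ (p * q) * (k * l)
  poly = solve-∀

∣*⇒∣∨∣ : ∀ {p} → Prime p → ∀ i j → + p ∣ i * j → (+ p ∣ i) ⊎ (+ p ∣ j)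
∣*⇒∣∨∣ {p} prime-p i j h with euclidsLemma (∣ i ∣) (∣ j ∣) prime-p (subst (p ℕ.∣_) (abs-* i j) (∣⇒∣ᵤ h))
... | inj₁ p∣i = inj₁ (∣ᵤ⇒∣ p∣i)
... | inj₂ p∣j = inj₂ (∣ᵤ⇒∣ p∣j)

∣*⇒∣ˡ : ∀ {p k w} → Prime p → ¬ (+ p ∣ k) → + p ∣ w * k → + p ∣ w
∣*⇒∣ˡ {k = k} {w} prime-p p∤k h = [ id , ⊥-elim ∘ p∤k ]′ (∣*⇒∣∨∣ prime-p w k h)

∣*⇒∣ʳ : ∀ {p k w} → Prime p → ¬ (+ p ∣ k) → + p ∣ k * w → + p ∣ w
∣*⇒∣ʳ {k = k} {w} prime-p p∤k h = [ ⊥-elim ∘ p∤k , id ]′ (∣*⇒∣∨∣ prime-p k w h)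

∣²⇒∣ : ∀ {p} → Prime p → ∀ y → + p ∣ y * y → + p ∣ y
∣²⇒∣ prime-p y h = [ id , id ]′ (∣*⇒∣∨∣ prime-p y y h)

prime-3 : Prime 3
prime-3 = from-yes (prime? 3)

3∤1 : ¬ (+ 3 ∣ + 1)
3∤1 h = from-no (3 ℕ.∣? 1) (∣⇒∣ᵤ h)

3∤2 : ¬ (+ 3 ∣ + 2)
3∤2 h = from-no (3 ℕ.∣? 2) (∣⇒∣ᵤ h)

3∤4 : ¬ (+ 3 ∣ + 4)
3∤4 h = from-no (3 ℕ.∣? 4) (∣⇒∣ᵤ h)

9∤4 : ¬ (+ 9 ∣ + 4)
9∤4 h = from-no (9 ℕ.∣? 4) (∣⇒∣ᵤ h)

27∤4*small : ∀ {N} → N ≢ + 0 → ∣ N ∣ ℕ.≤ 9 → ¬ (+ 27 ∣ N * + 4)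
27∤4*small {N} N≢0 ∣N∣≤9 27∣4N = ℕ.≤⇒≤ᵇ (ℕ.≤-trans (ℕ.∣⇒≤ (∣⇒∣ᵤ 27∣N)) ∣N∣≤9)
  where
  instance _ = ℕ.≢-nonZero (N≢0 ∘ ∣i∣≡0⇒i≡0)
  poly : ∀ N → + 7 * (N * + 4) - + 27 * N ≡ N
  poly = solve-∀
  27∣N : + 27 ∣ N
  27∣N = subst (+ 27 ∣_) (poly N) (∣m∣n⇒∣m-n (∣n⇒∣m*n (+ 7) 27∣4N) (∣m⇒∣m*n N ∣-refl))

cofactors : ∀ {a b N M K L} → a * b ≢ + 0 → K * a ≡ b * N → L * b ≡ a * M → N * M ≡ K * L
cofactors {a} {b} {N} {M} {K} {L} ab≢0 e₁ e₂ = *-cancelʳ-≡ (N * M) (K * L) (a * b) (begin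
  N * M * (a * b)     ≡⟨ poly₁ N M a b ⟩
  (b * N) * (a * M)   ≡⟨ cong₂ _*_ e₁ e₂ ⟨
  (K * a) * (L * b)   ≡⟨ poly₂ K L a b ⟩
  K * L * (a * b)     ∎)
  where
  open ≡-Reasoning
  instance _ = ≢-nonZero ab≢0
  poly₁ : ∀ N M a b → N * M * (a * b) ≡ (b * N) * (a * M)
  poly₁ = solve-∀
  poly₂ : ∀ K L a b → (K * a) * (L * b) ≡ K * L * (a * b)
  poly₂ = solve-∀

*≢0 : ∀ {i j} → i ≢ + 0 → j ≢ + 0 → i * j ≢ + 0
*≢0 {i} i≢0 j≢0 ij≡0 = [ i≢0 , j≢0 ]′ (i*j≡0⇒i≡0∨j≡0 i ij≡0)

*≡1+n⇒≢0ˡ : ∀ {i j n} → i * j ≡ + suc n → i ≢ + 0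
*≡1+n⇒≢0ˡ () refl

*≡1+n⇒≢0ʳ : ∀ {i j n} → i * j ≡ + suc n → j ≢ + 0
*≡1+n⇒≢0ʳ {i} e refl = ℕ.0≢1+n (cong ∣_∣ (trans (sym (*-zeroʳ i)) e))

*≡1+n⇒∣ˡ∣≤ : ∀ i j {n} → i * j ≡ + suc n → ∣ i ∣ ℕ.≤ suc n
*≡1+n⇒∣ˡ∣≤ i j {n} e = bound (∣ j ∣) (trans (sym (abs-* i j)) (cong ∣_∣ e))
  where
  bound : ∀ b → ∣ i ∣ ℕ.* b ≡ suc n → ∣ i ∣ ℕ.≤ suc n
  bound zero    e′ = ⊥-elim (ℕ.0≢1+n (trans (sym (ℕ.*-zeroʳ ∣ i ∣)) e′))
  bound (suc b) e′ = subst (∣ i ∣ ℕ.≤_) e′ (ℕ.m≤m*n (∣ i ∣) (suc b))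

*≡81⇒small-factor : ∀ i j → i * j ≡ + 81 → ∣ i ∣ ℕ.≤ 9 ⊎ ∣ j ∣ ℕ.≤ 9
*≡81⇒small-factor i j e with ∣ i ∣ ℕ.≤? 9 | ∣ j ∣ ℕ.≤? 9
... | yes ∣i∣≤9 | _         = inj₁ ∣i∣≤9
... | no _      | yes ∣j∣≤9 = inj₂ ∣j∣≤9
... | no ∣i∣≰9  | no ∣j∣≰9  = ⊥-elim (ℕ.≤⇒≤ᵇ (ℕ.≤-trans (ℕ.*-mono-≤ (ℕ.≰⇒> ∣i∣≰9) (ℕ.≰⇒> ∣j∣≰9))
                                               (ℕ.≤-reflexive (trans (sym (abs-* i j)) (cong ∣_∣ e)))))

neg-square : ∀ σ → σ * σ ≡ + 1 → - σ * - σ ≡ + 1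
neg-square σ σ²≡1 = trans (poly σ) σ²≡1
  where
  poly : ∀ σ → - σ * - σ ≡ σ * σ
  poly = solve-∀

∣i∣≡1⇒i≡±1 : ∀ {i} → ∣ i ∣ ≡ 1 → i ≡ + 1 ⊎ i ≡ -[1+ 0 ]
∣i∣≡1⇒i≡±1 {+ 1}      _ = inj₁ refl
∣i∣≡1⇒i≡±1 { -[1+ 0 ]} _ = inj₂ refl

vieta-bound : ∀ M A B → 7 ℕ.≤ M → 1 ℕ.≤ B → B ℕ.≤ A →
              9 ℕ.* (M ℕ.* (A ℕ.* B)) ℕ.≤ (A ℕ.+ B) ℕ.* (A ℕ.+ B) ℕ.+ 81 →
              (A ≡ 1 × B ≡ 1) ⊎ B ℕ.* B ℕ.+ 81 ℕ.< A ℕ.* A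
vieta-bound M A B 7≤M 1≤B B≤A hyp with B ℕ.* B ℕ.+ 81 ℕ.<? A ℕ.* A
... | yes lt = inj₂ lt
... | no ≮ = inj₁ (tiny A B 1≤B B≤A 63AB≤ AB≤2)
  where
  open ℕ.≤-Reasoning
  63AB≤ : 63 ℕ.* (A ℕ.* B) ℕ.≤ (A ℕ.+ B) ℕ.* (A ℕ.+ B) ℕ.+ 81
  63AB≤ = ℕ.≤-trans (ℕ.≤-reflexive (ℕ.*-assoc 9 7 (A ℕ.* B)))
            (ℕ.≤-trans (ℕ.*-monoʳ-≤ 9 (ℕ.*-monoˡ-≤ (A ℕ.* B) 7≤M)) hyp)
  square : ∀ A B → (A ℕ.+ B) ℕ.* (A ℕ.+ B) ℕ.+ 81 ≡ A ℕ.* A ℕ.+ 2 ℕ.* (A ℕ.* B) ℕ.+ B ℕ.* B ℕ.+ 81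
  square = ℕ-solve-∀
  split63 : ∀ P → 4 ℕ.* P ℕ.+ 59 ℕ.* P ≡ 63 ℕ.* P
  split63 = ℕ-solve-∀
  collect : ∀ P → P ℕ.+ 81 ℕ.+ 2 ℕ.* P ℕ.+ P ℕ.+ 81 ≡ 4 ℕ.* P ℕ.+ 162
  collect = ℕ-solve-∀
  59AB≤162 : 59 ℕ.* (A ℕ.* B) ℕ.≤ 162
  59AB≤162 = ℕ.+-cancelˡ-≤ (4 ℕ.* (A ℕ.* B)) _ _ (begin
    4 ℕ.* (A ℕ.* B) ℕ.+ 59 ℕ.* (A ℕ.* B)                ≡⟨ split63 (A ℕ.* B) ⟩
    63 ℕ.* (A ℕ.* B)                                     ≤⟨ 63AB≤ ⟩
    (A ℕ.+ B) ℕ.* (A ℕ.+ B) ℕ.+ 81                       ≡⟨ square A B ⟩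
    A ℕ.* A ℕ.+ 2 ℕ.* (A ℕ.* B) ℕ.+ B ℕ.* B ℕ.+ 81       ≤⟨ ℕ.+-monoˡ-≤ 81 (ℕ.+-mono-≤ (ℕ.+-monoˡ-≤ _ (ℕ.≮⇒≥ ≮)) B²≤AB) ⟩
    B ℕ.* B ℕ.+ 81 ℕ.+ 2 ℕ.* (A ℕ.* B) ℕ.+ A ℕ.* B ℕ.+ 81 ≤⟨ ℕ.+-monoˡ-≤ 81 (ℕ.+-monoˡ-≤ _ (ℕ.+-monoˡ-≤ _ (ℕ.+-monoˡ-≤ 81 B²≤AB))) ⟩
    A ℕ.* B ℕ.+ 81 ℕ.+ 2 ℕ.* (A ℕ.* B) ℕ.+ A ℕ.* B ℕ.+ 81 ≡⟨ collect (A ℕ.* B) ⟩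
    4 ℕ.* (A ℕ.* B) ℕ.+ 162                              ∎)
    where B²≤AB = ℕ.*-monoˡ-≤ B B≤A
  AB≤2 : A ℕ.* B ℕ.≤ 2
  AB≤2 with A ℕ.* B ℕ.≤? 2
  ... | yes p = p
  ... | no p = ⊥-elim (ℕ.≤⇒≤ᵇ (ℕ.≤-trans (ℕ.*-monoʳ-≤ 59 (ℕ.≰⇒> p)) 59AB≤162))
  tiny : ∀ A B → 1 ℕ.≤ B → B ℕ.≤ A → 63 ℕ.* (A ℕ.* B) ℕ.≤ (A ℕ.+ B) ℕ.* (A ℕ.+ B) ℕ.+ 81 →
         A ℕ.* B ℕ.≤ 2 → A ≡ 1 × B ≡ 1
  tiny 1 1 _ _ _ _ = refl , refl
  tiny 2 1 _ _ h _ = ⊥-elim (ℕ.≤⇒≤ᵇ h)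
  tiny _ 0 () _ _ _
  tiny 1 (suc (suc _)) _ (s≤s ()) _ _
  tiny 2 2 _ _ _ AB≤2 = ⊥-elim (ℕ.≤⇒≤ᵇ AB≤2)
  tiny 2 (suc (suc (suc _))) _ (s≤s (s≤s ())) _ _
  tiny (suc (suc (suc A))) (suc B) _ _ _ AB≤2 =
    ⊥-elim (ℕ.≤⇒≤ᵇ (ℕ.≤-trans (ℕ.*-mono-≤ (s≤s (s≤s (s≤s (z≤n {A})))) (s≤s (z≤n {B}))) AB≤2))

F : ℤ → ℤ → ℤ → ℤ
F m y s = (y + s) * (y + s) + + 9 * (m * (y * s))

jump : ℤ → ℤ → ℤ → ℤ
jump m y s = - ((+ 9 * m + + 2) * s) - y

F-sym : ∀ m y s → F m y s ≡ F m s y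
F-sym = poly
  where
  poly : ∀ m y s → (y + s) * (y + s) + + 9 * (m * (y * s)) ≡ (s + y) * (s + y) + + 9 * (m * (s * y))
  poly = solve-∀

F-jump : ∀ m y s → F m (jump m y s) s ≡ F m y s
F-jump = poly
  where
  poly : ∀ m y s → let j = - ((+ 9 * m + + 2) * s) - y in
         (j + s) * (j + s) + + 9 * (m * (j * s)) ≡ (y + s) * (y + s) + + 9 * (m * (y * s))
  poly = solve-∀

*-jump : ∀ m y s → y * jump m y s ≡ s * s - F m y s
*-jump = poly
  where
  poly : ∀ m y s → y * (- ((+ 9 * m + + 2) * s) - y) ≡ s * s - ((y + s) * (y + s) + + 9 * (m * (y * s)))
  poly = solve-∀

F-zeroʳ : ∀ m y → F m y (+ 0) ≡ y * y
F-zeroʳ = poly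
  where
  poly : ∀ m y → (y + + 0) * (y + + 0) + + 9 * (m * (y * + 0)) ≡ y * y
  poly = solve-∀

jump-involutive : ∀ m y s → jump m (jump m y s) s ≡ y
jump-involutive = poly
  where
  poly : ∀ m y s → - ((+ 9 * m + + 2) * s) - (- ((+ 9 * m + + 2) * s) - y) ≡ y
  poly = solve-∀

-- A jump keeps F m and, once 1 ≤ ∣ s ∣ ≤ ∣ y ∣, strictly decreases ∣ y ∣ by vieta-bound, except when
-- ∣ y ∣ = ∣ s ∣ = 1, which m + T ≢ 0 rules out; so every solution of F m y s ≡ 9T descends to s = 0.
module VietaJumping (m T : ℤ) (7≤∣m∣ : 7 ℕ.≤ ∣ m ∣) (∣T∣≤9 : ∣ T ∣ ℕ.≤ 9) (m+T≢0 : m + T ≢ + 0)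
  (P : ℤ → ℤ → Set)
  (P-sym  : ∀ {y s} → P s y → P y s)
  (P-jump : ∀ {y s} → P (jump m y s) s → P y s)
  (P-base : ∀ {y} → y * y ≡ + 9 * T → P y (+ 0)) where

  private
    ∣9T∣≤81 : ∣ + 9 * T ∣ ℕ.≤ 81
    ∣9T∣≤81 = ℕ.≤-trans (ℕ.≤-reflexive (abs-* (+ 9) T)) (ℕ.*-monoʳ-≤ 9 ∣T∣≤9)

    rearrange : ∀ a b → a ≡ (b + a) - b
    rearrange = solve-∀

    F-bound : ∀ y s → F m y s ≡ + 9 * T →
              9 ℕ.* (∣ m ∣ ℕ.* (∣ y ∣ ℕ.* ∣ s ∣)) ℕ.≤ (∣ y ∣ ℕ.+ ∣ s ∣) ℕ.* (∣ y ∣ ℕ.+ ∣ s ∣) ℕ.+ 81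
    F-bound y s F≡9T = begin
      9 ℕ.* (∣ m ∣ ℕ.* (∣ y ∣ ℕ.* ∣ s ∣))     ≡⟨ cong (9 ℕ.*_) (cong (∣ m ∣ ℕ.*_) (abs-* y s)) ⟨
      9 ℕ.* (∣ m ∣ ℕ.* ∣ y * s ∣)             ≡⟨ cong (9 ℕ.*_) (abs-* m (y * s)) ⟨
      9 ℕ.* ∣ m * (y * s) ∣                   ≡⟨ abs-* (+ 9) (m * (y * s)) ⟨
      ∣ + 9 * (m * (y * s)) ∣                  ≡⟨ cong ∣_∣ (rearrange (+ 9 * (m * (y * s))) ((y + s) * (y + s))) ⟩
      ∣ F m y s - (y + s) * (y + s) ∣          ≡⟨ cong (λ v → ∣ v - (y + s) * (y + s) ∣) F≡9T ⟩
      ∣ + 9 * T - (y + s) * (y + s) ∣          ≤⟨ ∣i-j∣≤∣i∣+∣j∣ (+ 9 * T) _ ⟩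
      ∣ + 9 * T ∣ ℕ.+ ∣ (y + s) * (y + s) ∣    ≤⟨ ℕ.+-mono-≤ ∣9T∣≤81 (ℕ.≤-reflexive (abs-* (y + s) (y + s))) ⟩
      81 ℕ.+ ∣ y + s ∣ ℕ.* ∣ y + s ∣          ≤⟨ ℕ.+-monoʳ-≤ 81 (ℕ.*-mono-≤ (∣i+j∣≤∣i∣+∣j∣ y s) (∣i+j∣≤∣i∣+∣j∣ y s)) ⟩
      81 ℕ.+ (∣ y ∣ ℕ.+ ∣ s ∣) ℕ.* (∣ y ∣ ℕ.+ ∣ s ∣) ≡⟨ ℕ.+-comm 81 _ ⟩
      (∣ y ∣ ℕ.+ ∣ s ∣) ℕ.* (∣ y ∣ ℕ.+ ∣ s ∣) ℕ.+ 81 ∎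
      where open ℕ.≤-Reasoning

    jump-bound : ∀ y s → F m y s ≡ + 9 * T →
                 ∣ y ∣ ℕ.* ∣ jump m y s ∣ ℕ.≤ ∣ s ∣ ℕ.* ∣ s ∣ ℕ.+ 81
    jump-bound y s F≡9T = begin
      ∣ y ∣ ℕ.* ∣ jump m y s ∣   ≡⟨ abs-* y (jump m y s) ⟨
      ∣ y * jump m y s ∣          ≡⟨ cong ∣_∣ (trans (*-jump m y s) (cong (λ v → s * s - v) F≡9T)) ⟩
      ∣ s * s - + 9 * T ∣         ≤⟨ ∣i-j∣≤∣i∣+∣j∣ (s * s) (+ 9 * T) ⟩
      ∣ s * s ∣ ℕ.+ ∣ + 9 * T ∣   ≤⟨ ℕ.+-mono-≤ (ℕ.≤-reflexive (abs-* s s)) ∣9T∣≤81 ⟩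
      ∣ s ∣ ℕ.* ∣ s ∣ ℕ.+ 81 ∎
      where open ℕ.≤-Reasoning

    F-one-one : F m (+ 1) (+ 1) ≢ + 9 * T
    F-one-one F≡9T = 9∤4 (divides (T - m) (begin
      + 4                          ≡⟨ poly₁ m ⟩
      F m (+ 1) (+ 1) - + 9 * m    ≡⟨ cong (_- + 9 * m) F≡9T ⟩
      + 9 * T - + 9 * m            ≡⟨ poly₂ T m ⟩
      (T - m) * + 9                ∎))
      where
      open ≡-Reasoning
      poly₁ : ∀ m → + 4 ≡ (+ 4 + + 9 * (m * + 1)) - + 9 * m
      poly₁ = solve-∀
      poly₂ : ∀ T m → + 9 * T - + 9 * m ≡ (T - m) * + 9
      poly₂ = solve-∀

    F-one-minus-one : F m (+ 1) -[1+ 0 ] ≢ + 9 * T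
    F-one-minus-one F≡9T = m+T≢0 (*-cancelˡ-≡ (+ 9) (m + T) (+ 0) (begin
      + 9 * (m + T)                ≡⟨ poly₁ m T ⟩
      + 9 * m + + 9 * T            ≡⟨ cong (λ v → + 9 * m + v) F≡9T ⟨
      + 9 * m + F m (+ 1) -[1+ 0 ] ≡⟨ poly₂ m ⟩
      + 0                          ≡⟨⟩
      + 9 * + 0                    ∎))
      where
      open ≡-Reasoning
      poly₁ : ∀ m T → + 9 * (m + T) ≡ + 9 * m + + 9 * T
      poly₁ = solve-∀
      poly₂ : ∀ m → + 9 * m + (+ 0 + + 9 * (m * - + 1)) ≡ + 0
      poly₂ = solve-∀

    F-units : ∀ {y s} → ∣ y ∣ ≡ 1 → ∣ s ∣ ≡ 1 → F m y s ≢ + 9 * T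
    F-units {y} {s} ∣y∣≡1 ∣s∣≡1 with ∣i∣≡1⇒i≡±1 {y} ∣y∣≡1 | ∣i∣≡1⇒i≡±1 {s} ∣s∣≡1
    ... | inj₁ refl | inj₁ refl = F-one-one
    ... | inj₂ refl | inj₂ refl = F-one-one
    ... | inj₁ refl | inj₂ refl = F-one-minus-one
    ... | inj₂ refl | inj₁ refl = F-one-minus-one

    -- structural recursion on a fuel bound n > ∣ y ∣ + ∣ s ∣
    mutual
      vieta : ∀ n y s → ∣ y ∣ ℕ.+ ∣ s ∣ ℕ.< n → F m y s ≡ + 9 * T → P y s
      vieta n y s b F≡9T with ∣ s ∣ ℕ.≤? ∣ y ∣
      ... | yes s≤y = vieta-≥ n y s s≤y b F≡9T
      ... | no  s≰y = P-sym (vieta-≥ n s y (ℕ.<⇒≤ (ℕ.≰⇒> s≰y))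
                               (subst (ℕ._< n) (ℕ.+-comm (∣ y ∣) (∣ s ∣)) b) (trans (F-sym m s y) F≡9T))

      vieta-≥ : ∀ n y s → ∣ s ∣ ℕ.≤ ∣ y ∣ → ∣ y ∣ ℕ.+ ∣ s ∣ ℕ.< n → F m y s ≡ + 9 * T → P y s
      vieta-≥ n y (+ 0)        _   _ F≡9T = P-base (trans (sym (F-zeroʳ m y)) F≡9T)
      vieta-≥ n y s@(+[1+ _ ]) s≤y b F≡9T = descend n y s (s≤s z≤n) s≤y b F≡9T
      vieta-≥ n y s@(-[1+ _ ]) s≤y b F≡9T = descend n y s (s≤s z≤n) s≤y b F≡9T

      descend : ∀ n y s → 1 ℕ.≤ ∣ s ∣ → ∣ s ∣ ℕ.≤ ∣ y ∣ → ∣ y ∣ ℕ.+ ∣ s ∣ ℕ.< n →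
                F m y s ≡ + 9 * T → P y s
      descend zero y s 1≤s s≤y () F≡9T
      descend (suc n) y s 1≤s s≤y b F≡9T =
        case vieta-bound (∣ m ∣) (∣ y ∣) (∣ s ∣) 7≤∣m∣ 1≤s s≤y (F-bound y s F≡9T) of λ where
          (inj₁ (∣y∣≡1 , ∣s∣≡1)) → ⊥-elim (F-units {y} {s} ∣y∣≡1 ∣s∣≡1 F≡9T)
          (inj₂ s²+81<y²) → P-jump (vieta n (jump m y s) s
            (ℕ.<-≤-trans (ℕ.+-monoˡ-< (∣ s ∣) (jump<y s²+81<y²)) (ℕ.≤-pred b)) (trans (F-jump m y s) F≡9T))
        where
        jump<y : ∣ s ∣ ℕ.* ∣ s ∣ ℕ.+ 81 ℕ.< ∣ y ∣ ℕ.* ∣ y ∣ → ∣ jump m y s ∣ ℕ.< ∣ y ∣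
        jump<y s²+81<y² = ℕ.*-cancelˡ-< (∣ y ∣) _ _ (ℕ.≤-<-trans (jump-bound y s F≡9T) s²+81<y²)

  vieta-induction : ∀ {y s} → F m y s ≡ + 9 * T → P y s
  vieta-induction {y} {s} = vieta _ y s (ℕ.n<1+n _)

module QuadraticField (D : ℤ) where

  -- (x + y√D)/2 has field norm (x² − D y²)/4
  N4 : Elt → ℤ
  N4 z = x z * x z - D * (y z * y z)

  infixr 7 _∙_
  infixl 7 _⊗_

  _∙_ : ℤ → Elt → Elt
  k ∙ z = ⟨ k * x z , k * y z ⟩

  -- α ⊗ β represents 2αβ, so IsProd D α β γ says exactly 2 ∙ γ ≡ α ⊗ β
  _⊗_ : Elt → Elt → Elt
  α ⊗ β = ⟨ x α * x β + D * (y α * y β) , x α * y β + x β * y α ⟩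

  ≡⊗⇒IsProd : ∀ {α β γ} → + 2 ∙ γ ≡ α ⊗ β → IsProd D α β γ
  ≡⊗⇒IsProd e = cong x e , cong y e

  N4-∙ : ∀ k z → N4 (k ∙ z) ≡ k * k * N4 z
  N4-∙ k z = poly D k (x z) (y z)
    where
    poly : ∀ D k a b → (k * a) * (k * a) - D * ((k * b) * (k * b)) ≡ k * k * (a * a - D * (b * b))
    poly = solve-∀

  1∙z≡z : ∀ z → + 1 ∙ z ≡ z
  1∙z≡z z = cong₂ ⟨_,_⟩ (*-identityˡ (x z)) (*-identityˡ (y z))

  ∣xy⇒≡∙ : ∀ {k z} → (k ∣ x z) × (k ∣ y z) → ∃ λ v → z ≡ k ∙ v
  ∣xy⇒≡∙ {k} (divides a x≡ak , divides b y≡bk) =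
    ⟨ a , b ⟩ , cong₂ ⟨_,_⟩ (trans x≡ak (*-comm a k)) (trans y≡bk (*-comm b k))

  one : Elt
  one = ⟨ + 2 , + 0 ⟩

  IsProd-oneʳ : ∀ z → IsProd D z one z
  IsProd-oneʳ z = poly₁ D (x z) (y z) , poly₂ (x z) (y z)
    where
    poly₁ : ∀ D a b → + 2 * a ≡ a * + 2 + D * (b * + 0)
    poly₁ = solve-∀
    poly₂ : ∀ a b → + 2 * b ≡ a * + 0 + + 2 * b
    poly₂ = solve-∀

  private
    commute : ∀ k a → + 2 * (k * a) ≡ k * (+ 2 * a)
    commute = solve-∀

  IsProd-scaleʳ : ∀ k {β c γ} → IsProd D β c γ → IsProd D β (k ∙ c) (k ∙ γ)
  IsProd-scaleʳ k {β} {c} {γ} (e₁ , e₂) =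
      trans (commute k (x γ)) (trans (cong (k *_) e₁) (poly₁ D k (x β) (y β) (x c) (y c)))
    , trans (commute k (y γ)) (trans (cong (k *_) e₂) (poly₂ k (x β) (y β) (x c) (y c)))
    where
    poly₁ : ∀ D k a b c d → k * (a * c + D * (b * d)) ≡ a * (k * c) + D * (b * (k * d))
    poly₁ = solve-∀
    poly₂ : ∀ k a b c d → k * (a * d + c * b) ≡ a * (k * d) + (k * c) * b
    poly₂ = solve-∀

  IsProd-unscaleʳ : ∀ k {β c γ} → k ≢ + 0 → IsProd D β (k ∙ c) (k ∙ γ) → IsProd D β c γ
  IsProd-unscaleʳ k {β} {c} {γ} k≢0 (e₁ , e₂) =
      *-cancelˡ-≡ k _ _ (trans (sym (commute k (x γ))) (trans e₁ (poly₁ D k (x β) (y β) (x c) (y c))))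
    , *-cancelˡ-≡ k _ _ (trans (sym (commute k (y γ))) (trans e₂ (poly₂ k (x β) (y β) (x c) (y c))))
    where
    instance _ = ≢-nonZero k≢0
    poly₁ : ∀ D k a b c d → a * (k * c) + D * (b * (k * d)) ≡ k * (a * c + D * (b * d))
    poly₁ = solve-∀
    poly₂ : ∀ k a b c d → a * (k * d) + (k * c) * b ≡ k * (a * d + c * b)
    poly₂ = solve-∀

  IsProd-assoc : ∀ {β j α i γ} → IsProd D β j α → IsProd D α i γ → IsProd D β (j ⊗ i) (+ 2 ∙ γ)
  IsProd-assoc {β} {j} {α} {i} {γ} (a₁ , a₂) (b₁ , b₂) =
      trans (cong (+ 2 *_) b₁) (trans (double₁ D (x α) (y α) (x i) (y i))
        (trans (cong₂ (λ u v → u * x i + D * (v * y i)) a₁ a₂) (poly₁ D (x β) (y β) (x j) (y j) (x i) (y i))))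
    , trans (cong (+ 2 *_) b₂) (trans (double₂ (x α) (y α) (x i) (y i))
        (trans (cong₂ (λ u v → u * y i + x i * v) a₁ a₂) (poly₂ D (x β) (y β) (x j) (y j) (x i) (y i))))
    where
    double₁ : ∀ D a b c d → + 2 * (a * c + D * (b * d)) ≡ (+ 2 * a) * c + D * ((+ 2 * b) * d)
    double₁ = solve-∀
    double₂ : ∀ a b c d → + 2 * (a * d + c * b) ≡ (+ 2 * a) * d + c * (+ 2 * b)
    double₂ = solve-∀
    poly₁ : ∀ D a b c d e f →
      (a * c + D * (b * d)) * e + D * ((a * d + c * b) * f) ≡ a * (c * e + D * (d * f)) + D * (b * (c * f + e * d))
    poly₁ = solve-∀
    poly₂ : ∀ D a b c d e f →
      (a * c + D * (b * d)) * f + e * (a * d + c * b) ≡ a * (c * f + e * d) + (c * e + D * (d * f)) * b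
    poly₂ = solve-∀

  IsProd-N4 : ∀ {α β γ} → IsProd D α β γ → + 4 * N4 γ ≡ N4 α * N4 β
  IsProd-N4 {α} {β} {γ} (e₁ , e₂) = begin
    + 4 * N4 γ                                                   ≡⟨ scale D (x γ) (y γ) ⟩
    (+ 2 * x γ) * (+ 2 * x γ) - D * ((+ 2 * y γ) * (+ 2 * y γ))  ≡⟨ cong₂ (λ a b → a * a - D * (b * b)) e₁ e₂ ⟩
    N4 (α ⊗ β)                                                   ≡⟨ brahmagupta D (x α) (y α) (x β) (y β) ⟩
    N4 α * N4 β                                                  ∎
    where
    open ≡-Reasoning
    scale : ∀ D a b → + 4 * (a * a - D * (b * b)) ≡ (+ 2 * a) * (+ 2 * a) - D * ((+ 2 * b) * (+ 2 * b))
    scale = solve-∀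
    brahmagupta : ∀ D a b c d →
      (a * c + D * (b * d)) * (a * c + D * (b * d)) - D * ((a * d + c * b) * (a * d + c * b))
        ≡ (a * a - D * (b * b)) * (c * c - D * (d * d))
    brahmagupta = solve-∀

  IsProd-N4-quotient : ∀ {β j γ N} → IsProd D β j γ → N4 j ≡ N * + 4 → N4 γ ≡ N4 β * N
  IsProd-N4-quotient {β} {j} {γ} {N} p N4j≡4N = *-cancelˡ-≡ (+ 4) _ _
    (trans (IsProd-N4 {β} {j} {γ} p) (trans (cong (N4 β *_) N4j≡4N) (poly (N4 β) N)))
    where
    poly : ∀ a N → a * (N * + 4) ≡ + 4 * (a * N)
    poly = solve-∀

  cofactor-norms : ∀ {α β j i N M} k l → N4 α ≢ + 0 → N4 β ≢ + 0 →
                   IsProd D β j (k ∙ α) → IsProd D α i (l ∙ β) → N4 j ≡ N * + 4 → N4 i ≡ M * + 4 →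
                   N * M ≡ (k * k) * (l * l)
  cofactor-norms {α} {β} {j} {i} {N} {M} k l N4α≢0 N4β≢0 p q N4j≡4N N4i≡4M =
    cofactors {N4 α} {N4 β} {N} {M} {k * k} {l * l} (*≢0 N4α≢0 N4β≢0)
      (trans (sym (N4-∙ k α)) (IsProd-N4-quotient {β} {j} {k ∙ α} p N4j≡4N))
      (trans (sym (N4-∙ l β)) (IsProd-N4-quotient {α} {i} {l ∙ β} q N4i≡4M))

  IsProd-cancelˡ : ∀ {β a b γ} → N4 β ≢ + 0 → IsProd D β a γ → IsProd D β b γ → a ≡ b
  IsProd-cancelˡ {β} {a} {b} {γ} N4β≢0 p q = cong₂ ⟨_,_⟩
      (*-cancelˡ-≡ (N4 β) (x a) (x b) (trans (conjugate-x p) (sym (conjugate-x q))))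
      (*-cancelˡ-≡ (N4 β) (y a) (y b) (trans (conjugate-y p) (sym (conjugate-y q))))
    where
    instance _ = ≢-nonZero N4β≢0
    -- multiplying γ = β c by the conjugate of β recovers N(β) c
    conjugate-x : ∀ {c} → IsProd D β c γ → N4 β * x c ≡ x β * (+ 2 * x γ) - D * (y β * (+ 2 * y γ))
    conjugate-x {c} (e₁ , e₂) = trans (poly D (x β) (y β) (x c) (y c)) (cong₂ (λ u v → x β * u - D * (y β * v)) (sym e₁) (sym e₂))
      where
      poly : ∀ D a b c d → (a * a - D * (b * b)) * c ≡ a * (a * c + D * (b * d)) - D * (b * (a * d + c * b))
      poly = solve-∀
    conjugate-y : ∀ {c} → IsProd D β c γ → N4 β * y c ≡ x β * (+ 2 * y γ) - y β * (+ 2 * x γ)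
    conjugate-y {c} (e₁ , e₂) = trans (poly D (x β) (y β) (x c) (y c)) (cong₂ (λ u v → x β * v - y β * u) (sym e₁) (sym e₂))
      where
      poly : ∀ D a b c d → (a * a - D * (b * b)) * d ≡ a * (a * d + c * b) - b * (a * c + D * (b * d))
      poly = solve-∀

  IsProd-quotient : ∀ {β u α c γ j} → N4 β ≢ + 0 →
                    IsProd D β u α → IsProd D α c γ → IsProd D β j γ → IsProd D u c j
  IsProd-quotient {β} {u} {α} {c} {γ} {j} N4β≢0 p q r = ≡⊗⇒IsProd {u} {c} {j} (sym
    (IsProd-cancelˡ {β} N4β≢0 (IsProd-assoc {β} {u} {α} {c} {γ} p q) (IsProd-scaleʳ (+ 2) {β} {j} {γ} r)))

  IsProd-twist : ∀ σ {r a γ} → IsProd D r a γ →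
    + 2 * (x γ - σ * y γ) ≡ (x r - σ * y r) * (x a - σ * y a) + (D - σ * σ) * (y r * y a)
  IsProd-twist σ {r} {a} {γ} (e₁ , e₂) =
    trans (poly₁ σ (x γ) (y γ)) (trans (cong₂ (λ u v → u - σ * v) e₁ e₂) (poly₂ D σ (x r) (y r) (x a) (y a)))
    where
    poly₁ : ∀ σ u v → + 2 * (u - σ * v) ≡ + 2 * u - σ * (+ 2 * v)
    poly₁ = solve-∀
    poly₂ : ∀ D σ a b c d →
      a * c + D * (b * d) - σ * (a * d + c * b) ≡ (a - σ * b) * (c - σ * d) + (D - σ * σ) * (b * d)
    poly₂ = solve-∀

  N4-twist : ∀ σ z → N4 z ≡ (x z - σ * y z) * (x z + σ * y z) - (D - σ * σ) * (y z * y z)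
  N4-twist σ z = poly D σ (x z) (y z)
    where
    poly : ∀ D σ a b → a * a - D * (b * b) ≡ (a - σ * b) * (a + σ * b) - (D - σ * σ) * (b * b)
    poly = solve-∀

Congruent : ℤ → ℤ → Elt → Set
Congruent n σ z = n ∣ x z - σ * y z

Congruent-zero : ∀ {n σ} → Congruent n σ zeroE
Congruent-zero {n} {σ} = divides (+ 0) (poly σ)
  where
  poly : ∀ σ → + 0 - σ * + 0 ≡ + 0
  poly = solve-∀

Congruent-+ : ∀ {n σ α β} → Congruent n σ α → Congruent n σ β → Congruent n σ (α +E β)
Congruent-+ {n} {σ} {α} {β} p q = subst (n ∣_) (poly σ (x α) (y α) (x β) (y β)) (∣m∣n⇒∣m+n p q)
  where
  poly : ∀ σ a b c d → (a - σ * b) + (c - σ * d) ≡ (a + c) - σ * (b + d)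
  poly = solve-∀

module RingOfIntegers (D : ℤ) (4∣D-1 : + 4 ∣ D - + 1) where
  open QuadraticField D

  InO⇒Congruent : ∀ {z} → InO D z → Congruent (+ 2) (+ 1) z
  InO⇒Congruent {z} (inj₁ (_ , 2∣x-y)) = subst (λ v → + 2 ∣ x z - v) (sym (*-identityˡ (y z))) (∣ᵤ⇒∣ 2∣x-y)
  InO⇒Congruent (inj₂ (4∤D-1 , _))     = ⊥-elim (4∤D-1 (∣⇒∣ᵤ 4∣D-1))

  Congruent⇒InO : ∀ {z} → Congruent (+ 2) (+ 1) z → InO D z
  Congruent⇒InO {z} 2∣x-y = inj₁ (∣⇒∣ᵤ 4∣D-1 , ∣⇒∣ᵤ (subst (λ v → + 2 ∣ x z - v) (*-identityˡ (y z)) 2∣x-y))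

  InO-* : ∀ {r α γ} → InO D r → InO D α → IsProd D r α γ → InO D γ
  InO-* {r} {α} {γ} r∈O α∈O p = Congruent⇒InO {γ} (*-cancelˡ-∣ (+ 2) (subst (+ 4 ∣_) (sym (IsProd-twist (+ 1) {r} {α} {γ} p))
    (∣m∣n⇒∣m+n (*-∣-* (InO⇒Congruent {r} r∈O) (InO⇒Congruent {α} α∈O)) (∣m⇒∣m*n (y r * y α) 4∣D-1))))

  one∈O : InO D one
  one∈O = Congruent⇒InO {one} (divides (+ 1) refl)

  O : Ideal D
  O = record
    { mem      = InO D
    ; sub      = id
    ; zero-mem = Congruent⇒InO {zeroE} (Congruent-zero {+ 2} {+ 1})
    ; add-mem  = λ {α} {β} p q →
        Congruent⇒InO {α +E β} (Congruent-+ {+ 2} {+ 1} {α} {β} (InO⇒Congruent {α} p) (InO⇒Congruent {β} q))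
    ; mul-mem  = λ {r} {α} {γ} → InO-* {r} {α} {γ}
    }

  InO⇒4∣N4 : ∀ {z} → InO D z → + 4 ∣ N4 z
  InO⇒4∣N4 {z} z∈O = subst (+ 4 ∣_) (sym (N4-twist (+ 1) z))
    (∣m∣n⇒∣m-n (*-∣-* 2∣x-y 2∣x+y) (∣m⇒∣m*n (y z * y z) 4∣D-1))
    where
    2∣x-y = InO⇒Congruent {z} z∈O
    2∣x+y : + 2 ∣ x z + + 1 * y z
    2∣x+y = subst (+ 2 ∣_) (poly (x z) (y z)) (∣m∣n⇒∣m+n 2∣x-y (∣m⇒∣m*n (y z) (∣-refl {+ 2})))
      where
      poly : ∀ a b → (a - + 1 * b) + + 2 * b ≡ a + + 1 * b
      poly = solve-∀

module SplitPrime (D : ℤ) (4∣D-1 : + 4 ∣ D - + 1) (3∣D-1 : + 3 ∣ D - + 1) where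
  open QuadraticField D
  open RingOfIntegers D 4∣D-1

  private
    3∣D-σ² : ∀ σ → σ * σ ≡ + 1 → + 3 ∣ D - σ * σ
    3∣D-σ² _ σ²≡1 = subst (λ v → + 3 ∣ D - v) (sym σ²≡1) 3∣D-1

  Congruent₃-* : ∀ {σ r α γ} → σ * σ ≡ + 1 → Congruent (+ 3) σ α → IsProd D r α γ → Congruent (+ 3) σ γ
  Congruent₃-* {σ} {r} {α} {γ} σ²≡1 3∣α p = ∣*⇒∣ʳ prime-3 3∤2 (subst (+ 3 ∣_) (sym (IsProd-twist σ {r} {α} {γ} p))
    (∣m∣n⇒∣m+n (∣n⇒∣m*n (x r - σ * y r) 3∣α) (∣m⇒∣m*n (y r * y α) (3∣D-σ² σ σ²≡1))))

  -- the two prime ideals above 3, which splits since D ≡ 1 (mod 3)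
  P : (σ : ℤ) → σ * σ ≡ + 1 → Ideal D
  P σ σ²≡1 = record
    { mem      = λ z → InO D z × Congruent (+ 3) σ z
    ; sub      = proj₁
    ; zero-mem = zero-mem O , Congruent-zero {+ 3} {σ}
    ; add-mem  = λ {α} {β} (α∈O , 3∣α) (β∈O , 3∣β) →
        add-mem O {α} {β} α∈O β∈O , Congruent-+ {+ 3} {σ} {α} {β} 3∣α 3∣β
    ; mul-mem  = λ {r} {α} {γ} r∈O (α∈O , 3∣α) p →
        mul-mem O {r} {α} {γ} r∈O α∈O p , Congruent₃-* {σ} {r} {α} {γ} σ²≡1 3∣α p
    }

  Congruent₃⇒3∣N4 : ∀ {σ} z → σ * σ ≡ + 1 → Congruent (+ 3) σ z → + 3 ∣ N4 z
  Congruent₃⇒3∣N4 {σ} z σ²≡1 3∣z = subst (+ 3 ∣_) (sym (N4-twist σ z))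
    (∣m∣n⇒∣m-n (∣m⇒∣m*n (x z + σ * y z) 3∣z) (∣m⇒∣m*n (y z * y z) (3∣D-σ² σ σ²≡1)))

  three : Elt
  three = + 3 ∙ one

  three∈P : ∀ σ σ²≡1 → mem (P σ σ²≡1) three
  three∈P σ _ = Congruent⇒InO {three} (divides (+ 3) refl) , divides (+ 2) (poly σ)
    where
    poly : ∀ σ → + 6 - σ * + 0 ≡ + 6
    poly = solve-∀

  -- ω σ = 1 + σ√D
  ω : ℤ → Elt
  ω σ = ⟨ + 2 , + 2 * σ ⟩

  ω∈P : ∀ σ σ²≡1 → mem (P σ σ²≡1) (ω σ)
  ω∈P σ σ²≡1 = Congruent⇒InO {ω σ} (divides (+ 1 - σ) (poly₁ σ))
             , divides (+ 0) (trans (poly₂ σ) (cong (λ v → + 2 * (+ 1 - v)) σ²≡1))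
    where
    poly₁ : ∀ σ → + 2 - + 1 * (+ 2 * σ) ≡ (+ 1 - σ) * + 2
    poly₁ = solve-∀
    poly₂ : ∀ σ → + 2 - σ * (+ 2 * σ) ≡ + 2 * (+ 1 - σ * σ)
    poly₂ = solve-∀

  _·ω_ : Elt → ℤ → Elt
  z ·ω σ = ⟨ x z + D * (σ * y z) , σ * x z + y z ⟩

  IsProd-ω : ∀ σ z → IsProd D z (ω σ) (z ·ω σ)
  IsProd-ω σ z = poly₁ D σ (x z) (y z) , poly₂ σ (x z) (y z)
    where
    poly₁ : ∀ D σ a b → + 2 * (a + D * (σ * b)) ≡ a * + 2 + D * (b * (+ 2 * σ))
    poly₁ = solve-∀
    poly₂ : ∀ σ a b → + 2 * (σ * a + b) ≡ a * (+ 2 * σ) + + 2 * b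
    poly₂ = solve-∀

  Congruent-ω : ∀ {σ u j} → σ * σ ≡ + 1 → IsProd D u (ω σ) j →
                Congruent (+ 3) (- σ) j → Congruent (+ 3) (- σ) u
  Congruent-ω {σ} {u} {j} σ²≡1 p 3∣j =
    ∣*⇒∣ˡ prime-3 3∤4 (∣m+n∣n⇒∣m (subst (+ 3 ∣_) twist (∣n⇒∣m*n (+ 2) 3∣j)) (∣m⇒∣m*n (y u * (+ 2 * σ)) 3∣D-1))
    where
    ω-twist : ∀ σ → + 2 - - σ * (+ 2 * σ) ≡ + 2 + + 2 * (σ * σ)
    ω-twist = solve-∀
    twist : + 2 * (x j - - σ * y j) ≡ (x u - - σ * y u) * + 4 + (D - + 1) * (y u * (+ 2 * σ))
    twist = trans (IsProd-twist (- σ) {u} {ω σ} {j} p)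
      (cong₂ (λ a b → (x u - - σ * y u) * a + (D - b) * (y u * (+ 2 * σ)))
        (trans (ω-twist σ) (cong (λ v → + 2 + + 2 * v) σ²≡1)) (neg-square σ σ²≡1))

module Descent (u : ℤ) (7≤∣m∣ : 7 ℕ.≤ ∣ + 6 * u + + 1 ∣) where

  m : ℤ
  m = + 6 * u + + 1

  D : ℤ
  D = Dof m

  4∣D-1 : + 4 ∣ D - + 1
  4∣D-1 = divides (+ 81 * (u * u) + + 33 * u + + 3) (poly u)
    where
    poly : ∀ u → let m = + 6 * u + + 1 in
           + 9 * (m * m) + + 4 * m - + 1 ≡ (+ 81 * (u * u) + + 33 * u + + 3) * + 4
    poly = solve-∀

  3∣D-1 : + 3 ∣ D - + 1
  3∣D-1 = divides (+ 108 * (u * u) + + 44 * u + + 4) (poly u)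
    where
    poly : ∀ u → let m = + 6 * u + + 1 in
           + 9 * (m * m) + + 4 * m - + 1 ≡ (+ 108 * (u * u) + + 44 * u + + 4) * + 3
    poly = solve-∀

  open QuadraticField D
  open RingOfIntegers D 4∣D-1

  private
    m+T≢0 : ∀ {T} → + 3 ∣ T → m + T ≢ + 0
    m+T≢0 {T} 3∣T m+T≡0 = 3∤1 (subst (+ 3 ∣_) (sym (trans (poly u T) (cong (_- (+ 3 * (+ 2 * u) + T)) m+T≡0)))
      (∣m∣n⇒∣m-n (divides (+ 0) refl) (∣m∣n⇒∣m+n (∣m⇒∣m*n (+ 2 * u) ∣-refl) 3∣T)))
      where
      poly : ∀ u T → + 1 ≡ (+ 6 * u + + 1 + T) - (+ 3 * (+ 2 * u) + T)
      poly = solve-∀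

    k : ∀ z → InO D z → ℤ
    k z z∈O = quotient (InO⇒Congruent {z} z∈O)

    x≡y+2k : ∀ z z∈O → x z ≡ y z + k z z∈O * + 2
    x≡y+2k z z∈O = trans (poly (x z) (y z)) (cong (λ v → y z + v) (_∣_.equality (InO⇒Congruent {z} z∈O)))
      where
      poly : ∀ a b → a ≡ b + (a - + 1 * b)
      poly = solve-∀

    -- F m has discriminant (9m + 2)² − 4 = 9D; this change of variables identifies it with the norm form
    s : ∀ z → InO D z → ℤ
    s z z∈O = + 3 * k z z∈O - (+ 27 * u + + 4) * y z

    F≡9N4 : ∀ z z∈O → + 4 * F m (y z) (s z z∈O) ≡ + 9 * N4 z
    F≡9N4 z z∈O = trans (poly u (y z) (k z z∈O)) (cong (λ a → + 9 * (a * a - D * (y z * y z))) (sym (x≡y+2k z z∈O)))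
      where
      poly : ∀ u y k → let m = + 6 * u + + 1 ; s = + 3 * k - (+ 27 * u + + 4) * y in
             + 4 * ((y + s) * (y + s) + + 9 * (m * (y * s)))
               ≡ + 9 * ((y + k * + 2) * (y + k * + 2) - (+ 9 * (m * m) + + 4 * m) * (y * y))
      poly = solve-∀

    3x≡ : ∀ z z∈O → + 3 * x z ≡ (+ 54 * u + + 9) * y z + + 2 * (y z + s z z∈O)
    3x≡ z z∈O = trans (cong (+ 3 *_) (x≡y+2k z z∈O)) (poly u (y z) (k z z∈O))
      where
      poly : ∀ u y k → let s = + 3 * k - (+ 27 * u + + 4) * y in
             + 3 * (y + k * + 2) ≡ (+ 54 * u + + 9) * y + + 2 * (y + s)
      poly = solve-∀

    F≡9T : ∀ z z∈O {T} → N4 z ≡ T * + 4 → F m (y z) (s z z∈O) ≡ + 9 * T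
    F≡9T z z∈O {T} N4≡4T = *-cancelˡ-≡ (+ 4) _ _ (trans (F≡9N4 z z∈O) (trans (cong (+ 9 *_) N4≡4T) (poly T)))
      where
      poly : ∀ T → + 9 * (T * + 4) ≡ + 4 * (+ 9 * T)
      poly = solve-∀

    P₃ : ℤ → ℤ → Set
    P₃ y s = (+ 3 ∣ y) × (+ 9 ∣ y + s)

    9∣⇒3∣ : ∀ {a} → + 9 ∣ a → + 3 ∣ a
    9∣⇒3∣ = ∣-trans (divides (+ 3) refl)

    P₃-sym : ∀ {y s} → P₃ s y → P₃ y s
    P₃-sym {y} {s} (3∣s , 9∣s+y) = ∣m+n∣m⇒∣n (9∣⇒3∣ 9∣s+y) 3∣s , subst (+ 9 ∣_) (poly s y) 9∣s+y
      where
      poly : ∀ s y → s + y ≡ y + s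
      poly = solve-∀

    P₃-jump : ∀ {y s} → P₃ (jump m y s) s → P₃ y s
    P₃-jump {y} {s} (3∣j , 9∣j+s) = subst (+ 3 ∣_) (jump-involutive m y s) 3∣y , subst (+ 9 ∣_) (sym (poly m y s)) 9∣y+s
      where
      3∣s = ∣m+n∣m⇒∣n (9∣⇒3∣ 9∣j+s) 3∣j
      3∣y = ∣m∣n⇒∣m-n (∣m⇒∣-m (∣n⇒∣m*n (+ 9 * m + + 2) 3∣s)) 3∣j
      9∣y+s = ∣m∣n⇒∣m-n (∣m⇒∣-m (∣m⇒∣m*n (m * s) (∣-refl {+ 9}))) 9∣j+s
      poly : ∀ m y s → y + s ≡ - (+ 9 * (m * s)) - ((- ((+ 9 * m + + 2) * s) - y) + s)
      poly = solve-∀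

    P₃-base : ∀ {T} → + 3 ∣ T → ∀ {y} → y * y ≡ + 9 * T → P₃ y (+ 0)
    P₃-base {T} 3∣T {y} y²≡9T = 3∣y , subst (+ 9 ∣_) (sym (+-identityʳ y)) 9∣y
      where
      3∣y = ∣²⇒∣ prime-3 y (divides (+ 3 * T) (trans y²≡9T (poly₁ T)))
        where
        poly₁ : ∀ T → + 9 * T ≡ + 3 * T * + 3
        poly₁ = solve-∀
      a = quotient 3∣y
      a²≡T : a * a ≡ T
      a²≡T = *-cancelˡ-≡ (+ 9) _ _ (trans (poly₂ a) (trans (cong (λ v → v * v) (sym (_∣_.equality 3∣y))) y²≡9T))
        where
        poly₂ : ∀ a → + 9 * (a * a) ≡ (a * + 3) * (a * + 3)
        poly₂ = solve-∀
      9∣y : + 9 ∣ y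
      9∣y = subst (+ 9 ∣_) (sym (_∣_.equality 3∣y)) (*-∣-* (∣²⇒∣ prime-3 a (subst (+ 3 ∣_) (sym a²≡T) 3∣T)) (∣-refl {+ 3}))

    P₀ : ℤ → ℤ → Set
    P₀ y s = y ≡ + 0 × s ≡ + 0

    P₀-jump : ∀ {y s} → P₀ (jump m y s) s → P₀ y s
    P₀-jump {y} (j≡0 , refl) =
      trans (sym (jump-involutive m y (+ 0))) (trans (cong (λ v → jump m v (+ 0)) j≡0) (poly m)) , refl
      where
      poly : ∀ m → - ((+ 9 * m + + 2) * + 0) - + 0 ≡ + 0
      poly = solve-∀

    P₀-base : ∀ {y} → y * y ≡ + 9 * + 0 → P₀ y (+ 0)
    P₀-base {y} y²≡0 = [ id , id ]′ (i*j≡0⇒i≡0∨j≡0 y y²≡0) , refl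

  small-N4⇒3∣ : ∀ z → InO D z → ∀ {T} → N4 z ≡ T * + 4 → + 3 ∣ T → ∣ T ∣ ℕ.≤ 9 → (+ 3 ∣ x z) × (+ 3 ∣ y z)
  small-N4⇒3∣ z z∈O {T} N4≡4T 3∣T ∣T∣≤9 = 3∣x , 3∣y
    where
    P₃-ys : P₃ (y z) (s z z∈O)
    P₃-ys = VietaJumping.vieta-induction m T 7≤∣m∣ ∣T∣≤9 (m+T≢0 3∣T) P₃ P₃-sym P₃-jump (P₃-base 3∣T) (F≡9T z z∈O N4≡4T)

    3∣y = proj₁ P₃-ys
    3∣x : + 3 ∣ x z
    3∣x = *-cancelˡ-∣ (+ 3) (subst (+ 9 ∣_) (sym (3x≡ z z∈O))
      (∣m∣n⇒∣m+n (∣m⇒∣m*n (y z) (divides (+ 6 * u + + 1) (poly u))) (∣n⇒∣m*n (+ 2) (proj₂ P₃-ys))))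
      where
      poly : ∀ u → + 54 * u + + 9 ≡ (+ 6 * u + + 1) * + 9
      poly = solve-∀

  N4≡0⇒≡zeroE : ∀ z → InO D z → N4 z ≡ + 0 → z ≡ zeroE
  N4≡0⇒≡zeroE z z∈O N4≡0 = cong₂ ⟨_,_⟩ x≡0 (proj₁ P₀-ys)
    where
    P₀-ys : P₀ (y z) (s z z∈O)
    P₀-ys = VietaJumping.vieta-induction m (+ 0) 7≤∣m∣ z≤n (m+T≢0 (divides (+ 0) refl))
              P₀ (λ (s≡0 , y≡0) → y≡0 , s≡0) P₀-jump P₀-base (F≡9T z z∈O {+ 0} N4≡0)

    x≡0 : x z ≡ + 0
    x≡0 = *-cancelˡ-≡ (+ 3) (x z) (+ 0) (trans (3x≡ z z∈O)
      (trans (cong₂ (λ a b → (+ 54 * u + + 9) * a + + 2 * (a + b)) (proj₁ P₀-ys) (proj₂ P₀-ys)) (poly u)))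
      where
      poly : ∀ u → (+ 54 * u + + 9) * + 0 + + 2 * (+ 0 + + 0) ≡ + 0
      poly = solve-∀

module ClassGroup (u : ℤ) (7≤∣m∣ : 7 ℕ.≤ ∣ + 6 * u + + 1 ∣) where
  open Descent u 7≤∣m∣
  open QuadraticField D
  open RingOfIntegers D 4∣D-1
  open SplitPrime D 4∣D-1 3∣D-1
  open Equivalence using (to; from)

  N4≢0 : ∀ {z} → InO D z → z ≢ zeroE → N4 z ≢ + 0
  N4≢0 {z} z∈O z≢0 = z≢0 ∘ N4≡0⇒≡zeroE z z∈O

  small-norm-in-P⇒3∣ : ∀ {σ j N} → σ * σ ≡ + 1 → InO D j → Congruent (+ 3) σ j →
                       N4 j ≡ N * + 4 → ∣ N ∣ ℕ.≤ 9 → (+ 3 ∣ x j) × (+ 3 ∣ y j)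
  small-norm-in-P⇒3∣ {σ} {j} {N} σ²≡1 j∈O 3∣j N4j≡4N ∣N∣≤9 = small-N4⇒3∣ j j∈O {N} N4j≡4N
    (∣*⇒∣ˡ prime-3 3∤4 (subst (+ 3 ∣_) N4j≡4N (Congruent₃⇒3∣N4 {σ} j σ²≡1 3∣j))) ∣N∣≤9

  O≁P : ∀ σ σ²≡1 → ¬ SameClass D O (P σ σ²≡1)
  O≁P σ σ²≡1 (α , β , α∈O , α≢0 , β∈O , β≢0 , αO≈βP) = 3∤4 (subst (+ 3 ∣_) (sym (proj₁ j₁i₂≡ω)) 3∣j₁i₂)
    where
    A = to (αO≈βP (+ 1 ∙ α)) (one , one∈O , IsProd-scaleʳ (+ 1) {α} {one} {α} (IsProd-oneʳ α))
    j₁ = proj₁ A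
    j₁∈P = proj₁ (proj₂ A)
    B = from (αO≈βP (+ 3 ∙ β)) (three , three∈P σ σ²≡1 , IsProd-scaleʳ (+ 3) {β} {one} {β} (IsProd-oneʳ β))
    i₁ = proj₁ B
    C = from (αO≈βP (β ·ω σ)) (ω σ , ω∈P σ σ²≡1 , IsProd-ω σ β)
    i₂ = proj₁ C
    4∣N4j₁ = InO⇒4∣N4 {j₁} (proj₁ j₁∈P)
    4∣N4i₁ = InO⇒4∣N4 {i₁} (proj₁ (proj₂ B))
    N₁ = quotient 4∣N4j₁
    N₂ = quotient 4∣N4i₁
    N₁N₂≡9 : N₁ * N₂ ≡ + 9
    N₁N₂≡9 = cofactor-norms {α} {β} {j₁} {i₁} {N₁} {N₂} (+ 1) (+ 3) (N4≢0 {α} α∈O α≢0) (N4≢0 {β} β∈O β≢0)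
      (proj₂ (proj₂ A)) (proj₂ (proj₂ B)) (_∣_.equality 4∣N4j₁) (_∣_.equality 4∣N4i₁)
    3∣j₁ = small-norm-in-P⇒3∣ {σ} {j₁} {N₁} σ²≡1 (proj₁ j₁∈P) (proj₂ j₁∈P) (_∣_.equality 4∣N4j₁)
      (*≡1+n⇒∣ˡ∣≤ N₁ N₂ N₁N₂≡9)
    j₁i₂≡ω : IsProd D j₁ i₂ (ω σ)
    j₁i₂≡ω = IsProd-quotient {β} {j₁} {α} {i₂} {β ·ω σ} {ω σ} (N4≢0 {β} β∈O β≢0)
      (subst (IsProd D β j₁) (1∙z≡z α) (proj₂ (proj₂ A))) (proj₂ (proj₂ C)) (IsProd-ω σ β)
    3∣j₁i₂ : + 3 ∣ x j₁ * x i₂ + D * (y j₁ * y i₂)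
    3∣j₁i₂ = ∣m∣n⇒∣m+n (∣m⇒∣m*n (x i₂) (proj₁ 3∣j₁)) (∣n⇒∣m*n D (∣m⇒∣m*n (y i₂) (proj₂ 3∣j₁)))

  module _ {σ τ} (σ²≡1 : σ * σ ≡ + 1) (τ²≡1 : τ * τ ≡ + 1) (τ≡-σ : τ ≡ - σ) where

    -- β j = 3 α with j ∈ P τ of small norm forces j = 3 v with v ∈ P τ, so 27 ∣ N(j)
    P≁P-half : ∀ {α β} → N4 β ≢ + 0 →
               (∀ γ → InScaled D α (P σ σ²≡1) γ → InScaled D β (P τ τ²≡1) γ) →
               ∀ {j N} → mem (P τ τ²≡1) j → IsProd D β j (+ 3 ∙ α) →
               N4 j ≡ N * + 4 → N ≢ + 0 → ∣ N ∣ ℕ.≤ 9 → ⊥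
    P≁P-half {α} {β} N4β≢0 αP⊆βP {j} {N} (j∈O , 3∣j) βj≡3α N4j≡4N N≢0 ∣N∣≤9 =
      27∤4*small N≢0 ∣N∣≤9 (27∣4N (∣xy⇒≡∙ {+ 3} {j} (small-norm-in-P⇒3∣ {τ} {j} {N} τ²≡1 j∈O 3∣j N4j≡4N ∣N∣≤9)))
      where
      27∣4N : (∃ λ v → j ≡ + 3 ∙ v) → + 27 ∣ N * + 4
      27∣4N (v , j≡3v) = subst (+ 27 ∣_) N4j≡9N4v (*-∣-* (∣-refl {+ 9}) 3∣N4v)
        where
        βv≡α : IsProd D β v α
        βv≡α = IsProd-unscaleʳ (+ 3) {β} {v} {α} (λ ()) (subst (λ w → IsProd D β w (+ 3 ∙ α)) j≡3v βj≡3α)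
        C = αP⊆βP (α ·ω σ) (ω σ , ω∈P σ σ²≡1 , IsProd-ω σ α)
        j₂ = proj₁ C
        vω≡j₂ : IsProd D v (ω σ) j₂
        vω≡j₂ = IsProd-quotient {β} {v} {α} {ω σ} {α ·ω σ} {j₂} N4β≢0 βv≡α (IsProd-ω σ α) (proj₂ (proj₂ C))
        3∣N4v : + 3 ∣ N4 v
        3∣N4v = Congruent₃⇒3∣N4 { - σ} v (neg-square σ σ²≡1)
          (Congruent-ω {σ} {v} {j₂} σ²≡1 vω≡j₂ (subst (λ t → Congruent (+ 3) t j₂) τ≡-σ (proj₂ (proj₁ (proj₂ C)))))
        N4j≡9N4v : + 9 * N4 v ≡ N * + 4
        N4j≡9N4v = trans (sym (N4-∙ (+ 3) v)) (trans (cong N4 (sym j≡3v)) N4j≡4N)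

  P≁P : ∀ σ σ²≡1 τ τ²≡1 → τ ≡ - σ → ¬ SameClass D (P σ σ²≡1) (P τ τ²≡1)
  P≁P σ σ²≡1 τ τ²≡1 τ≡-σ (α , β , α∈O , α≢0 , β∈O , β≢0 , αP≈βP) =
    [ P≁P-half {σ} {τ} σ²≡1 τ²≡1 τ≡-σ {α} {β} (N4≢0 {β} β∈O β≢0) (λ γ → to (αP≈βP γ)) {j₁} {N₁}
        (proj₁ (proj₂ A)) (proj₂ (proj₂ A)) (_∣_.equality 4∣N4j₁) (*≡1+n⇒≢0ˡ {N₁} {N₂} N₁N₂≡81)
    , P≁P-half {τ} {σ} τ²≡1 σ²≡1 σ≡-τ {β} {α} (N4≢0 {α} α∈O α≢0) (λ γ → from (αP≈βP γ)) {i₁} {N₂}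
        (proj₁ (proj₂ B)) (proj₂ (proj₂ B)) (_∣_.equality 4∣N4i₁) (*≡1+n⇒≢0ʳ {N₁} {N₂} N₁N₂≡81)
    ]′ (*≡81⇒small-factor N₁ N₂ N₁N₂≡81)
    where
    σ≡-τ : σ ≡ - τ
    σ≡-τ = trans (sym (neg-involutive σ)) (cong -_ (sym τ≡-σ))
    A = to (αP≈βP (+ 3 ∙ α)) (three , three∈P σ σ²≡1 , IsProd-scaleʳ (+ 3) {α} {one} {α} (IsProd-oneʳ α))
    B = from (αP≈βP (+ 3 ∙ β)) (three , three∈P τ τ²≡1 , IsProd-scaleʳ (+ 3) {β} {one} {β} (IsProd-oneʳ β))
    j₁ = proj₁ A
    i₁ = proj₁ B
    4∣N4j₁ = InO⇒4∣N4 {j₁} (proj₁ (proj₁ (proj₂ A)))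
    4∣N4i₁ = InO⇒4∣N4 {i₁} (proj₁ (proj₁ (proj₂ B)))
    N₁ = quotient 4∣N4j₁
    N₂ = quotient 4∣N4i₁
    N₁N₂≡81 : N₁ * N₂ ≡ + 81
    N₁N₂≡81 = cofactor-norms {α} {β} {j₁} {i₁} {N₁} {N₂} (+ 3) (+ 3) (N4≢0 {α} α∈O α≢0) (N4≢0 {β} β∈O β≢0)
      (proj₂ (proj₂ A)) (proj₂ (proj₂ B)) (_∣_.equality 4∣N4j₁) (_∣_.equality 4∣N4i₁)

  class-number≥3 : ClassNumber≥3 D
  class-number≥3 = O , P (+ 1) refl , P -[1+ 0 ] refl
                 , (one , one∈O , λ ()) , (three , three∈P (+ 1) refl , λ ()) , (three , three∈P -[1+ 0 ] refl , λ ())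
                 , O≁P (+ 1) refl , O≁P -[1+ 0 ] refl , P≁P (+ 1) refl -[1+ 0 ] refl refl

SquareFree-Dof⇒odd : ∀ m → SquareFree (Dof m) → ∃ λ q → m ≡ + 2 * q + + 1
SquareFree-Dof⇒odd m sf = by-parity (m %ℕ 2) (a≡a%ℕn+[a/ℕn]*n m 2) (n%ℕd<d m 2)
  where
  q = m /ℕ 2
  by-parity : ∀ r → m ≡ + r + q * + 2 → r ℕ.< 2 → ∃ λ q → m ≡ + 2 * q + + 1
  by-parity 0 m≡2q _ = ⊥-elim (2≢1 (sf 2 (ℕ.divides ∣ + 9 * (q * q) + + 2 * q ∣
    (trans (cong (∣_∣ ∘ Dof) m≡2q) (trans (cong ∣_∣ (poly q)) (abs-* (+ 9 * (q * q) + + 2 * q) (+ 4)))))))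
    where
    2≢1 : 2 ≢ 1
    2≢1 ()
    poly : ∀ q → let m = + 0 + q * + 2 in + 9 * (m * m) + + 4 * m ≡ (+ 9 * (q * q) + + 2 * q) * + 4
    poly = solve-∀
  by-parity 1 m≡2q+1 _ = q , trans m≡2q+1 (poly q)
    where
    poly : ∀ q → + 1 + q * + 2 ≡ + 2 * q + + 1
    poly = solve-∀
  by-parity (suc (suc _)) _ (s≤s (s≤s ()))

-- 3m − 2m = m
≡1[3]∧≡1[2]⇒≡1[6] : ∀ {m t q} → m ≡ + 3 * t + + 1 → m ≡ + 2 * q + + 1 → m ≡ + 6 * (q - t) + + 1
≡1[3]∧≡1[2]⇒≡1[6] {m} {t} {q} m≡3t+1 m≡2q+1 =
  trans (poly₁ m) (trans (cong₂ (λ a b → + 3 * a - + 2 * b) m≡2q+1 m≡3t+1) (poly₂ t q))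
  where
  poly₁ : ∀ m → m ≡ + 3 * m - + 2 * m
  poly₁ = solve-∀
  poly₂ : ∀ t q → + 3 * (+ 2 * q + + 1) - + 2 * (+ 3 * t + + 1) ≡ + 6 * (q - t) + + 1
  poly₂ = solve-∀

7≤∣6u+1∣ : ∀ u → + 6 * u + + 1 ≢ + 1 → + 6 * u + + 1 ≢ -[1+ 4 ] → 7 ℕ.≤ ∣ + 6 * u + + 1 ∣
7≤∣6u+1∣ (+ 0)          m≢1 _   = ⊥-elim (m≢1 refl)
7≤∣6u+1∣ +[1+ k ]       _   _   = ℕ.+-monoˡ-≤ 1 (ℕ.*-monoʳ-≤ 6 (s≤s (z≤n {k})))
7≤∣6u+1∣ -[1+ 0 ]       _   m≢-5 = ⊥-elim (m≢-5 refl)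
7≤∣6u+1∣ -[1+ suc k ]   _   _   = subst (7 ℕ.≤_) 11+6k≡∣m∣ (ℕ.≤-trans (ℕ.m≤m+n 7 4) (ℕ.m≤m+n 11 (6 ℕ.* k)))
  where
  open ≡-Reasoning
  poly : ∀ k → + 6 * - (+ 2 + k) + + 1 ≡ - (+ 11 + + 6 * k)
  poly = solve-∀
  11+6k≡∣m∣ : 11 ℕ.+ 6 ℕ.* k ≡ ∣ + 6 * -[1+ suc k ] + + 1 ∣
  11+6k≡∣m∣ = begin
    ∣ + 11 + + (6 ℕ.* k) ∣            ≡⟨ cong (λ v → ∣ + 11 + v ∣) (pos-* 6 k) ⟩
    ∣ + 11 + + 6 * + k ∣              ≡⟨ ∣-i∣≡∣i∣ (+ 11 + + 6 * + k) ⟨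
    ∣ - (+ 11 + + 6 * + k) ∣          ≡⟨ cong ∣_∣ (poly (+ k)) ⟨
    ∣ + 6 * -[1+ suc k ] + + 1 ∣      ∎

theorem1p2 : (m : ℤ) → (+ 3) ∣ᵤ (m - + 1) → SquareFree (Dof m) →
    ¬ (m ≡ -[1+ 4 ]) → ¬ (m ≡ + 1) → ClassNumber≥3 (Dof m)
theorem1p2 m 3∣m-1 sf m≢-5 m≢1 = subst (ClassNumber≥3 ∘ Dof) (sym m≡6u+1) (ClassGroup.class-number≥3 u 7≤∣m∣)
  where
  3∣m-1′ : + 3 ∣ m - + 1
  3∣m-1′ = ∣ᵤ⇒∣ 3∣m-1
  t = quotient 3∣m-1′
  m≡3t+1 : m ≡ + 3 * t + + 1
  m≡3t+1 = trans (poly₁ m) (trans (cong (_+ + 1) (_∣_.equality 3∣m-1′)) (poly₂ t))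
    where
    poly₁ : ∀ m → m ≡ (m - + 1) + + 1
    poly₁ = solve-∀
    poly₂ : ∀ t → t * + 3 + + 1 ≡ + 3 * t + + 1
    poly₂ = solve-∀
  odd = SquareFree-Dof⇒odd m sf
  q = proj₁ odd
  u = q - t
  m≡6u+1 : m ≡ + 6 * u + + 1
  m≡6u+1 = ≡1[3]∧≡1[2]⇒≡1[6] {m} {t} {q} m≡3t+1 (proj₂ odd)
  7≤∣m∣ : 7 ℕ.≤ ∣ + 6 * u + + 1 ∣
  7≤∣m∣ = 7≤∣6u+1∣ u (λ e → m≢1 (trans m≡6u+1 e)) (λ e → m≢-5 (trans m≡6u+1 e))
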